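{- Let $N$ be a positive integer and $1\leq a\leq N$. Then the degree of $a$ in the Diophantine graph $D(\{1,\dots,N\})$ is at most $8\sqrt{N/a}\cdot 2^{\omega(a)}$.
   Context: For a finite set $V$ of positive integers, the Diophantine graph $D(V)$ has vertex set $V$, and two distinct elements $a,b\in V$ are linked by an edge if and only if $ab+1$ is a perfect square. $\omega(a)$ denotes the number of distinct prime divisors of $a$. -}

module Defs where

open import Data.Nat using (ℕ; zero; suc; _+_; _*_; _≤_; _<_; s≤s; z≤n)
open import Data.Nat.Properties using (_≟_; anyUpTo?; m≤m*n; ≤-trans; n≤1+n)
open import Data.Nat.Divisibility using (_∣_; _∣?_)
open import Data.Nat.Primality using (Prime; prime?)
open import Data.List using (List; length; filter; upTo; map)
open import Data.Product using (∃; _,_; _×_)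
open import Relation.Nullary using (Dec; yes; no; ¬_; _×-dec_)
open import Relation.Nullary.Decidable using (¬?)
open import Relation.Binary.PropositionalEquality using (_≡_; refl; subst; sym)

IsSquare : ℕ → Set
IsSquare n = ∃ λ k → k * k ≡ n

private
  root-bound : ∀ k n → k * k ≡ n → k < suc n
  root-bound zero n _ = s≤s z≤n
  root-bound (suc k) n eq = s≤s (subst (suc k ≤_) eq (m≤m*n (suc k) (suc k)))

isSquare? : (n : ℕ) → Dec (IsSquare n)
isSquare? n with anyUpTo? (λ k → k * k ≟ n) (suc n)
... | yes (k , _ , eq) = yes (k , eq)
... | no ¬p = no λ { (k , eq) → ¬p (k , root-bound k n eq , eq) }

[1‥_] : ℕ → List ℕ
[1‥ N ] = map suc (upTo N)

Adjacent : ℕ → ℕ → Set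
Adjacent a b = (¬ a ≡ b) × IsSquare (a * b + 1)

adjacent? : (a b : ℕ) → Dec (Adjacent a b)
adjacent? a b = ¬? (a ≟ b) ×-dec isSquare? (a * b + 1)

degree : ℕ → ℕ → ℕ
degree N a = length (filter (adjacent? a) [1‥ N ])

-- ω(a) : number of distinct primes dividing a (for a ≥ 1 all such primes are ≤ a)
ω : ℕ → ℕ
ω a = length (filter (λ p → prime? p ×-dec p ∣? a) (upTo (suc a)))

{-# OPTIONS --safe #-}
-- A neighbour b of a in D({1,…,N}) is determined by x = √(ab + 1), which is a square root of 1
-- modulo a with x² ≤ aN + 1. Writing x = q a + r, the remainder r is one of the ρ(a) square roots
-- of 1 modulo a and the quotient satisfies q² a ≤ N + 1, so deg(a) ≤ (Q + 1) ρ(a) for the largest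
-- such Q, and (Q + 1)² a ≤ 16 N. By the Chinese remainder theorem ρ is submultiplicative on coprime
-- factors, while ρ(p^k) ≤ 2 for odd primes p and ρ(2^k) ≤ 4; hence ρ(a) ≤ 2 · 2^ω(a) and
-- deg(a)² a ≤ 16 N · 4 · 4^ω(a).
module Submission where

open import Defs
open import Data.Nat using (ℕ; _*_; _^_; _≤_)
open import Data.Nat.Base
  using (zero; suc; _+_; _∸_; _<_; s≤s; z≤n; z<s; s≤s⁻¹; NonZero; >-nonZero; >-nonZero⁻¹; nonTrivial⇒n>1)
open import Data.Nat.Properties
open import Data.Nat.DivMod
  using (_/_; _%_; m≡m%n+[m/n]*n; m%n<n; %-distribˡ-*; m∣n⇒o%n%m≡o%m; m<n⇒m%n≡m; [m+kn]%n≡m%n; m/n*n≤m)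
open import Data.Nat.Divisibility
open import Data.Nat.Primality
  using (Prime; prime?; prime[2]; ¬prime[1]; prime⇒nonZero; prime⇒nonTrivial; prime⇒irreducible; euclidsLemma)
open import Data.Nat.Primality.Factorisation using (factorise)
open import Data.Nat.ListAction using (product)
open import Data.Nat.Induction using (<-wellFounded)
open import Data.Nat.Solver using (module +-*-Solver)
open import Data.Fin.Base as Fin using (Fin; zero; suc; toℕ; fromℕ<; combine; remQuot)
open import Data.Fin.Properties using (injective⇒≤; remQuot-combine; toℕ-fromℕ<)
open import Data.List.Base using (List; []; _∷_; length; lookup; filter; upTo)
open import Data.List.Properties using (length-filter; length-upTo)
open import Data.List.Membership.Propositional using (_∈_)
open import Data.List.Membership.Propositional.Properties
  using (∈-lookup; ∈-filter⁺; ∈-filter⁻; ∈-upTo⁺; ∈-upTo⁻; ∈-map⁻)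
open import Data.List.Membership.Setoid.Properties using (index-injective)
open import Data.List.Relation.Binary.Subset.Propositional using (_⊆_)
open import Data.List.Relation.Unary.All as All using (_∷_)
open import Data.List.Relation.Unary.Any using (here; there; index)
open import Data.List.Relation.Unary.AllPairs using (_∷_)
open import Data.List.Relation.Unary.Unique.Propositional using (Unique)
open import Data.List.Relation.Unary.Unique.Propositional.Properties using (upTo⁺; filter⁺; map⁺)
open import Data.Product using (∃; ∃₂; _×_; _,_; proj₁; proj₂)
open import Data.Product.Properties using (,-injectiveˡ; ,-injectiveʳ)
open import Data.Sum using (_⊎_; inj₁; inj₂)
open import Induction.WellFounded using (Acc; acc)
open import Relation.Nullary using (¬_; yes; no; contradiction; _×-dec_)
open import Relation.Unary using (Decidable)
open import Relation.Binary.PropositionalEquality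

open +-*-Solver using (solve; _:=_; _:+_; _:*_; con)

module _ {ℓ} {A : Set ℓ} where

  lookup-injective : ∀ {xs : List A} → Unique xs → ∀ {i j} → lookup xs i ≡ lookup xs j → i ≡ j
  lookup-injective (_ ∷ _)     {zero}  {zero}  _  = refl
  lookup-injective (x∉xs ∷ _)  {zero}  {suc j} eq = contradiction eq (All.lookup x∉xs (∈-lookup j))
  lookup-injective (x∉xs ∷ _)  {suc i} {zero}  eq = contradiction (sym eq) (All.lookup x∉xs (∈-lookup i))
  lookup-injective (_ ∷ uniq)  {suc i} {suc j} eq = cong Fin.suc (lookup-injective uniq eq)

  length-≤-by-injection : ∀ {xs : List A} {n} → Unique xs → (f : ∀ {x} → x ∈ xs → Fin n) →
                          (∀ {x y} (x∈ : x ∈ xs) (y∈ : y ∈ xs) → f x∈ ≡ f y∈ → x ≡ y) →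
                          length xs ≤ n
  length-≤-by-injection uniq f f-injective =
    injective⇒≤ λ {i} {j} eq → lookup-injective uniq (f-injective (∈-lookup i) (∈-lookup j) eq)

  Unique-⊆⇒length-≤ : ∀ {xs ys : List A} → Unique xs → xs ⊆ ys → length xs ≤ length ys
  Unique-⊆⇒length-≤ uniq xs⊆ys = length-≤-by-injection uniq (λ x∈ → index (xs⊆ys x∈))
    λ x∈ y∈ → index-injective (setoid A) (xs⊆ys x∈) (xs⊆ys y∈)

combine-injective : ∀ {m n} {i i′ : Fin m} {j j′ : Fin n} →
                    combine i j ≡ combine i′ j′ → i ≡ i′ × j ≡ j′
combine-injective {n = n} {i} {i′} {j} {j′} eq = ,-injectiveˡ same-pair , ,-injectiveʳ same-pair
  where
  same-pair = trans (sym (remQuot-combine i j)) (trans (cong (remQuot n) eq) (remQuot-combine i′ j′))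

module _ {P : ℕ → Set} (P? : Decidable P) where

  greatest : ℕ → ℕ
  greatest zero = 0
  greatest (suc n) with P? (suc n)
  ... | yes _ = suc n
  ... | no _  = greatest n

  greatest-satisfies : P 0 → ∀ n → P (greatest n)
  greatest-satisfies P0 zero = P0
  greatest-satisfies P0 (suc n) with P? (suc n)
  ... | yes P[1+n] = P[1+n]
  ... | no _       = greatest-satisfies P0 n

  greatest-≥ : ∀ {i n} → i ≤ n → P i → i ≤ greatest n
  greatest-≥ {n = zero} i≤0 _ = i≤0
  greatest-≥ {i} {suc n} i≤1+n Pi with P? (suc n) | m≤n⇒m<n∨m≡n i≤1+n
  ... | yes _  | _          = i≤1+n
  ... | no ¬Pi | inj₂ refl  = contradiction Pi ¬Pi
  ... | no _   | inj₁ i<1+n = greatest-≥ (s≤s⁻¹ i<1+n) Pi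

m≤m*m*n : ∀ m n .{{_ : NonZero n}} → m ≤ m * m * n
m≤m*m*n zero    n = z≤n
m≤m*m*n (suc m) n = ≤-trans (m≤m*n (suc m) (suc m)) (m≤m*n (suc m * suc m) n)

m^n*m^n≡[m*m]^n : ∀ m n → m ^ n * m ^ n ≡ (m * m) ^ n
m^n*m^n≡[m*m]^n m zero    = refl
m^n*m^n≡[m*m]^n m (suc n) = begin
  (m * m ^ n) * (m * m ^ n)   ≡⟨ solve 2 (λ m t → (m :* t) :* (m :* t) := (m :* m) :* (t :* t)) refl m (m ^ n) ⟩
  (m * m) * (m ^ n * m ^ n)   ≡⟨ cong ((m * m) *_) (m^n*m^n≡[m*m]^n m n) ⟩
  (m * m) * (m * m) ^ n       ∎
  where open ≡-Reasoning

/-%-injective : ∀ {n} .{{_ : NonZero n}} {x y} → x / n ≡ y / n → x % n ≡ y % n → x ≡ y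
/-%-injective {n} {x = x} {y} x/n≡y/n x%n≡y%n = begin
  x                     ≡⟨ m≡m%n+[m/n]*n x n ⟩
  x % n + (x / n) * n   ≡⟨ cong₂ (λ r q → r + q * n) x%n≡y%n x/n≡y/n ⟩
  y % n + (y / n) * n   ≡⟨ m≡m%n+[m/n]*n y n ⟨
  y                     ∎
  where open ≡-Reasoning

%-≡⇒∣∸ : ∀ {n} .{{_ : NonZero n}} {x y} → x % n ≡ y % n → n ∣ y ∸ x
%-≡⇒∣∸ {n} {x = x} {y} x%n≡y%n = divides (y / n ∸ x / n) (begin
  y ∸ x                                           ≡⟨ cong₂ _∸_ (m≡m%n+[m/n]*n y n) (m≡m%n+[m/n]*n x n) ⟩
  (y % n + (y / n) * n) ∸ (x % n + (x / n) * n)   ≡⟨ cong (λ r → y % n + (y / n) * n ∸ (r + (x / n) * n)) x%n≡y%n ⟩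
  (y % n + (y / n) * n) ∸ (y % n + (x / n) * n)   ≡⟨ [m+n]∸[m+o]≡n∸o (y % n) _ _ ⟩
  (y / n) * n ∸ (x / n) * n                       ≡⟨ *-distribʳ-∸ n (y / n) (x / n) ⟨
  (y / n ∸ x / n) * n                             ∎)
  where open ≡-Reasoning

∣∧<⇒≡0 : ∀ {d z} → d ∣ z → z < d → z ≡ 0
∣∧<⇒≡0 {z = zero}  _   _   = refl
∣∧<⇒≡0 {z = suc z} d∣z z<d = contradiction (∣⇒≤ d∣z) (<⇒≱ z<d)

∣∧≤2*⇒≡0⊎≡⊎≡2* : ∀ {d z} .{{_ : NonZero d}} → d ∣ z → z ≤ 2 * d → z ≡ 0 ⊎ z ≡ d ⊎ z ≡ 2 * d
∣∧≤2*⇒≡0⊎≡⊎≡2* {d} (divides t refl) t*d≤2*d with *-cancelʳ-≤ t 2 d t*d≤2*d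
... | z≤n           = inj₁ refl
... | s≤s z≤n       = inj₂ (inj₁ (+-identityʳ d))
... | s≤s (s≤s z≤n) = inj₂ (inj₂ refl)

module _ {u v} .{{_ : NonZero u}} .{{_ : NonZero v}} (u⊥v : ∀ {o} → u ∣ v * o → u ∣ o) where

  private
    crt-unique-≤ : ∀ {x y} → x ≤ y → y < u * v → x % u ≡ y % u → x % v ≡ y % v → x ≡ y
    crt-unique-≤ {x} {y} x≤y y<uv x≡y[u] x≡y[v] =
      ≤-antisym x≤y (m∸n≡0⇒m≤n (∣∧<⇒≡0 uv∣y∸x (≤-<-trans (m∸n≤m y x) y<uv)))
      where
      uv∣y∸x : u * v ∣ y ∸ x
      uv∣y∸x with divides t y∸x≡t*v ← %-≡⇒∣∸ x≡y[v] =
        subst (u * v ∣_) (sym y∸x≡t*v) (*-monoˡ-∣ v (u⊥v u∣v*t))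
        where
        u∣v*t : u ∣ v * t
        u∣v*t = subst (u ∣_) (trans y∸x≡t*v (*-comm t v)) (%-≡⇒∣∸ x≡y[u])

  crt-unique : ∀ {x y} → x < u * v → y < u * v → x % u ≡ y % u → x % v ≡ y % v → x ≡ y
  crt-unique {x} {y} x<uv y<uv x≡y[u] x≡y[v] with ≤-total x y
  ... | inj₁ x≤y = crt-unique-≤ x≤y y<uv x≡y[u] x≡y[v]
  ... | inj₂ y≤x = sym (crt-unique-≤ y≤x x<uv (sym x≡y[u]) (sym x≡y[v]))

prime⇒>1 : ∀ {p} → Prime p → 1 < p
prime⇒>1 {p} p-prime = nonTrivial⇒n>1 p {{prime⇒nonTrivial p-prime}}

prime^≢0 : ∀ {p} → Prime p → ∀ k → NonZero (p ^ k)
prime^≢0 p-prime k = m^n≢0 _ k {{prime⇒nonZero p-prime}}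

prime∣2⇒≡2 : ∀ {p} → Prime p → p ∣ 2 → p ≡ 2
prime∣2⇒≡2 p-prime p∣2 with prime⇒irreducible prime[2] p∣2
... | inj₁ refl = contradiction p-prime ¬prime[1]
... | inj₂ p≡2  = p≡2

prime^-divisor : ∀ {p n o} → Prime p → ¬ p ∣ n → ∀ k → p ^ k ∣ n * o → p ^ k ∣ o
prime^-divisor _ _ zero _ = 1∣ _
prime^-divisor {p} {n} {o} p-prime p∤n (suc k) p^[1+k]∣n*o
  with euclidsLemma n o p-prime (∣-trans (m∣m*n (p ^ k)) p^[1+k]∣n*o)
... | inj₁ p∣n = contradiction p∣n p∤n
... | inj₂ (divides o′ refl) =
  subst (_∣ o′ * p) (*-comm (p ^ k) p) (*-monoˡ-∣ p (prime^-divisor p-prime p∤n k p^k∣n*o′))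
  where
  instance _ = prime⇒nonZero p-prime
  p^k∣n*o′ : p ^ k ∣ n * o′
  p^k∣n*o′ = *-cancelʳ-∣ p (subst₂ _∣_ (*-comm p (p ^ k)) (sym (*-assoc n o′ p)) p^[1+k]∣n*o)

2∣n⇒2∤1+n : ∀ {n} → 2 ∣ n → ¬ 2 ∣ suc n
2∣n⇒2∤1+n {n} 2∣n 2∣1+n with () ← ∣1⇒≡1 (∣m+n∣m⇒∣n (subst (2 ∣_) (+-comm 1 n) 2∣1+n) 2∣n)

2∣m*[2+m]⇒2∣m : ∀ {m} → 2 ∣ m * (2 + m) → 2 ∣ m
2∣m*[2+m]⇒2∣m {m} 2∣m*[2+m] with euclidsLemma m (2 + m) prime[2] 2∣m*[2+m]
... | inj₁ 2∣m   = 2∣m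
... | inj₂ 2∣2+m = ∣m+n∣m⇒∣n 2∣2+m (∣-refl {2})

module _ (n : ℕ) .{{_ : NonZero n}} where

  IsSqrtOfOne : ℕ → Set
  IsSqrtOfOne x = x * x % n ≡ 1 % n

  isSqrtOfOne? : Decidable IsSqrtOfOne
  isSqrtOfOne? x = x * x % n ≟ 1 % n

  sqrtsOfOne : List ℕ
  sqrtsOfOne = filter isSqrtOfOne? (upTo n)

  ρ : ℕ
  ρ = length sqrtsOfOne

module _ {n : ℕ} .{{_ : NonZero n}} where

  sqrtsOfOne-unique : Unique (sqrtsOfOne n)
  sqrtsOfOne-unique = filter⁺ (isSqrtOfOne? n) (upTo⁺ n)

  ∈-sqrtsOfOne⁺ : ∀ {x} → x < n → IsSqrtOfOne n x → x ∈ sqrtsOfOne n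
  ∈-sqrtsOfOne⁺ x<n = ∈-filter⁺ (isSqrtOfOne? n) (∈-upTo⁺ x<n)

  ∈-sqrtsOfOne⁻ : ∀ {x} → x ∈ sqrtsOfOne n → x < n × IsSqrtOfOne n x
  ∈-sqrtsOfOne⁻ x∈ with x∈upTo , x²≡1 ← ∈-filter⁻ (isSqrtOfOne? n) x∈ = ∈-upTo⁻ x∈upTo , x²≡1

  ρ≤n : ρ n ≤ n
  ρ≤n = ≤-trans (length-filter (isSqrtOfOne? n) (upTo n)) (≤-reflexive (length-upTo n))

  square⇒IsSqrtOfOne : ∀ {x b} → x * x ≡ n * b + 1 → IsSqrtOfOne n x
  square⇒IsSqrtOfOne {x} {b} x²≡nb+1 = begin
    x * x % n        ≡⟨ cong (_% n) (trans x²≡nb+1 (trans (+-comm (n * b) 1) (cong (1 +_) (*-comm n b)))) ⟩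
    (1 + b * n) % n  ≡⟨ [m+kn]%n≡m%n 1 b n ⟩
    1 % n            ∎
    where open ≡-Reasoning

  module _ (1<n : 1 < n) where

    ¬IsSqrtOfOne[0] : ¬ IsSqrtOfOne n 0
    ¬IsSqrtOfOne[0] 0≡1%n =
      0≢1+n (trans (sym (m<n⇒m%n≡m {m = 0} (<-trans z<s 1<n))) (trans 0≡1%n (m<n⇒m%n≡m 1<n)))

    IsSqrtOfOne⇒∣ : ∀ {y} → IsSqrtOfOne n (suc y) → n ∣ y * (2 + y)
    IsSqrtOfOne⇒∣ {y} [1+y]²≡1 = divides (suc y * suc y / n) (+-cancelˡ-≡ 1 _ _ (begin
      1 + y * (2 + y)                               ≡⟨ solve 1 (λ y → con 1 :+ y :* (con 2 :+ y)
                                                                     := (con 1 :+ y) :* (con 1 :+ y)) refl y ⟩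
      suc y * suc y                                 ≡⟨ m≡m%n+[m/n]*n (suc y * suc y) n ⟩
      suc y * suc y % n + (suc y * suc y / n) * n   ≡⟨ cong (_+ (suc y * suc y / n) * n)
                                                            (trans [1+y]²≡1 (m<n⇒m%n≡m 1<n)) ⟩
      1 + (suc y * suc y / n) * n                   ∎))
      where open ≡-Reasoning

%-∈-sqrtsOfOne : ∀ {n u x} .{{_ : NonZero n}} .{{_ : NonZero u}} →
                 u ∣ n → IsSqrtOfOne n x → x % u ∈ sqrtsOfOne u
%-∈-sqrtsOfOne {n} {u} {x} u∣n x²≡1 = ∈-sqrtsOfOne⁺ (m%n<n x u) (begin
  (x % u) * (x % u) % u  ≡⟨ %-distribˡ-* x x u ⟨
  x * x % u              ≡⟨ m∣n⇒o%n%m≡o%m u n (x * x) u∣n ⟨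
  x * x % n % u          ≡⟨ cong (_% u) x²≡1 ⟩
  1 % n % u              ≡⟨ m∣n⇒o%n%m≡o%m u n 1 u∣n ⟩
  1 % u                  ∎)
  where open ≡-Reasoning

ρ-* : ∀ u v .{{_ : NonZero u}} .{{_ : NonZero v}} → (∀ {o} → u ∣ v * o → u ∣ o) →
      ρ (u * v) {{m*n≢0 u v}} ≤ ρ u * ρ v
ρ-* u v u⊥v = length-≤-by-injection (sqrtsOfOne-unique {u * v}) code code-injective
  where
  instance _ = m*n≢0 u v
  residue-u : ∀ {x} → x ∈ sqrtsOfOne (u * v) → x % u ∈ sqrtsOfOne u
  residue-u x∈ = %-∈-sqrtsOfOne {u * v} {u} (m∣m*n v) (proj₂ (∈-sqrtsOfOne⁻ {u * v} x∈))
  residue-v : ∀ {x} → x ∈ sqrtsOfOne (u * v) → x % v ∈ sqrtsOfOne v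
  residue-v x∈ = %-∈-sqrtsOfOne {u * v} {v} (n∣m*n u) (proj₂ (∈-sqrtsOfOne⁻ {u * v} x∈))
  code : ∀ {x} → x ∈ sqrtsOfOne (u * v) → Fin (ρ u * ρ v)
  code x∈ = combine (index (residue-u x∈)) (index (residue-v x∈))
  code-injective : ∀ {x y} (x∈ : x ∈ sqrtsOfOne (u * v)) (y∈ : y ∈ sqrtsOfOne (u * v)) →
                   code x∈ ≡ code y∈ → x ≡ y
  code-injective x∈ y∈ eq with ≡ᵤ , ≡ᵥ ← combine-injective eq =
    crt-unique u⊥v (proj₁ (∈-sqrtsOfOne⁻ {u * v} x∈)) (proj₁ (∈-sqrtsOfOne⁻ {u * v} y∈))
      (index-injective (setoid ℕ) (residue-u x∈) (residue-u y∈) ≡ᵤ)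
      (index-injective (setoid ℕ) (residue-v x∈) (residue-v y∈) ≡ᵥ)

module _ {p} (p-prime : Prime p) (k : ℕ) where
  private instance
    p^[1+k]≢0 : NonZero (p ^ suc k)
    p^[1+k]≢0 = prime^≢0 p-prime (suc k)

  1<p^[1+k] : 1 < p ^ suc k
  1<p^[1+k] = <-≤-trans (prime⇒>1 p-prime) (m≤m*n p (p ^ k) {{prime^≢0 p-prime k}})

  -- A root x = y + 1 has p^(k+1) ∣ y (y + 2), and an odd p divides at most one of the two factors.
  ρ-odd-prime-power≤2 : p ≢ 2 → ρ (p ^ suc k) ≤ 2
  ρ-odd-prime-power≤2 p≢2 = Unique-⊆⇒length-≤ (sqrtsOfOne-unique {n}) λ x∈ → ±1 (∈-sqrtsOfOne⁻ x∈)
    where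
    n = p ^ suc k
    ±1 : ∀ {x} → x < n × IsSqrtOfOne n x → x ∈ 1 ∷ n ∸ 1 ∷ []
    ±1 {zero}  (_ , 0²≡1) = contradiction 0²≡1 (¬IsSqrtOfOne[0] 1<p^[1+k])
    ±1 {suc y} (x<n , x²≡1) with n∣y[2+y] ← IsSqrtOfOne⇒∣ 1<p^[1+k] {y} x²≡1 | p ∣? y
    ... | yes p∣y = here (cong suc (∣∧<⇒≡0 n∣y (<-trans (n<1+n y) x<n)))
      where
      p∤2+y : ¬ p ∣ 2 + y
      p∤2+y p∣2+y = p≢2 (prime∣2⇒≡2 p-prime (∣m+n∣m⇒∣n (subst (p ∣_) (+-comm 2 y) p∣2+y) p∣y))
      n∣y : n ∣ y
      n∣y = prime^-divisor p-prime p∤2+y (suc k) (subst (n ∣_) (*-comm y (2 + y)) n∣y[2+y])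
    ... | no p∤y = there (here (cong (_∸ 1) (≤-antisym x<n (∣⇒≤ n∣2+y))))
      where
      n∣2+y : n ∣ 2 + y
      n∣2+y = prime^-divisor p-prime p∤y (suc k) n∣y[2+y]

ρ-2-power≤4 : ∀ k → ρ (2 ^ k) {{m^n≢0 2 k}} ≤ 4
ρ-2-power≤4 zero          = ≤-trans (ρ≤n {1}) (s≤s z≤n)
ρ-2-power≤4 (suc zero)    = ≤-trans (ρ≤n {2}) (s≤s (s≤s z≤n))
ρ-2-power≤4 (suc (suc j)) =
  Unique-⊆⇒length-≤ (sqrtsOfOne-unique {n}) λ x∈ → candidates (∈-sqrtsOfOne⁻ x∈)
  where
  d = 2 ^ j
  n = 2 * (2 * d)
  instance
    d≢0 : NonZero d
    d≢0 = m^n≢0 2 j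
    n≢0 : NonZero n
    n≢0 = m^n≢0 2 (2 + j)

  -- A root is x = 2u + 1 with 2^j ∣ u (u + 1), and one of u, u + 1 is odd: x ≡ ±1 modulo 2^(j+1).
  Candidate : ℕ → Set
  Candidate x = x ∈ 1 ∷ suc (d * 2) ∷ d * 2 ∸ 1 ∷ 2 * d * 2 ∸ 1 ∷ []

  candidate : ∀ u → u < 2 * d → d ∣ u * suc u → Candidate (suc (u * 2))
  candidate u u<2d d∣u[1+u] with 2 ∣? u
  ... | yes 2∣u with ∣∧≤2*⇒≡0⊎≡⊎≡2* (prime^-divisor prime[2] (2∣n⇒2∤1+n 2∣u) j
                                       (subst (d ∣_) (*-comm u (suc u)) d∣u[1+u])) (<⇒≤ u<2d)
  ...   | inj₁ refl        = here refl
  ...   | inj₂ (inj₁ refl) = there (here refl)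
  ...   | inj₂ (inj₂ refl) = contradiction u<2d (<-irrefl refl)
  candidate u u<2d d∣u[1+u] | no 2∤u
    with ∣∧≤2*⇒≡0⊎≡⊎≡2* (prime^-divisor prime[2] 2∤u j d∣u[1+u]) u<2d
  ...   | inj₂ (inj₁ 1+u≡d)  = there (there (here (cong (λ w → w * 2 ∸ 1) 1+u≡d)))
  ...   | inj₂ (inj₂ 1+u≡2d) = there (there (there (here (cong (λ w → w * 2 ∸ 1) 1+u≡2d))))

  1<n : 1 < n
  1<n = m≤m*n 2 (2 * d) {{m*n≢0 2 d}}

  candidates : ∀ {x} → x < n × IsSqrtOfOne n x → Candidate x
  candidates {zero}  (_ , 0²≡1) = contradiction 0²≡1 (¬IsSqrtOfOne[0] 1<n)
  candidates {suc y} (x<n , x²≡1)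
    with n∣y[2+y] ← IsSqrtOfOne⇒∣ 1<n {y} x²≡1
    with divides u refl ← 2∣m*[2+m]⇒2∣m {y} (∣-trans (m∣m*n (2 * d)) n∣y[2+y])
    = candidate u (*-cancelʳ-< 2 u (2 * d) (subst (suc (u * 2) ≤_) (*-comm 2 (2 * d)) (<⇒≤ x<n)))
        (*-cancelˡ-∣ 2 (*-cancelˡ-∣ 2 (subst (n ∣_) 2u[2+2u]≡4u[1+u] n∣y[2+y])))
    where
    2u[2+2u]≡4u[1+u] : u * 2 * (2 + u * 2) ≡ 2 * (2 * (u * suc u))
    2u[2+2u]≡4u[1+u] =
      solve 1 (λ u → u :* con 2 :* (con 2 :+ u :* con 2) := con 2 :* (con 2 :* (u :* (con 1 :+ u)))) refl u

primeDivisors : ℕ → List ℕ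
primeDivisors a = filter (λ p → prime? p ×-dec p ∣? a) (upTo (suc a))

primeDivisors-unique : ∀ a → Unique (primeDivisors a)
primeDivisors-unique a = filter⁺ (λ p → prime? p ×-dec p ∣? a) (upTo⁺ (suc a))

∈-primeDivisors⁻ : ∀ {p a} → p ∈ primeDivisors a → Prime p × p ∣ a
∈-primeDivisors⁻ {a = a} p∈ = proj₂ (∈-filter⁻ (λ p → prime? p ×-dec p ∣? a) {xs = upTo (suc a)} p∈)

∈-primeDivisors⁺ : ∀ {p a} .{{_ : NonZero a}} → Prime p → p ∣ a → p ∈ primeDivisors a
∈-primeDivisors⁺ {a = a} p-prime p∣a =
  ∈-filter⁺ (λ p → prime? p ×-dec p ∣? a) (∈-upTo⁺ (s≤s (∣⇒≤ p∣a))) (p-prime , p∣a)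

ω-cofactor : ∀ {p m a} .{{_ : NonZero a}} → Prime p → p ∣ a → m ∣ a → ¬ p ∣ m → suc (ω m) ≤ ω a
ω-cofactor {p} {m} {a} p-prime p∣a m∣a p∤m =
  Unique-⊆⇒length-≤ {ys = primeDivisors a} (All.tabulate p∉ ∷ primeDivisors-unique m) p∷primeDivisors[m]⊆
  where
  p∉ : ∀ {q} → q ∈ primeDivisors m → p ≢ q
  p∉ q∈ refl = p∤m (proj₂ (∈-primeDivisors⁻ {a = m} q∈))
  p∷primeDivisors[m]⊆ : p ∷ primeDivisors m ⊆ primeDivisors a
  p∷primeDivisors[m]⊆ (here refl) = ∈-primeDivisors⁺ p-prime p∣a
  p∷primeDivisors[m]⊆ (there q∈) with q-prime , q∣m ← ∈-primeDivisors⁻ {a = m} q∈ =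
    ∈-primeDivisors⁺ q-prime (∣-trans q∣m m∣a)

≡1⊎∃prime∣ : ∀ a .{{_ : NonZero a}} → a ≡ 1 ⊎ ∃ λ p → Prime p × p ∣ a
≡1⊎∃prime∣ a with factorise a
... | record { factors = [] ; isFactorisation = a≡1 } = inj₁ a≡1
... | record { factors = p ∷ ps ; isFactorisation = a≡p*Πps ; factorsPrime = p-prime ∷ _ } =
  inj₂ (p , p-prime , divides (product ps) (trans a≡p*Πps (*-comm p (product ps))))

prime-power-split : ∀ {p} → Prime p → ∀ a .{{_ : NonZero a}} → p ∣ a →
                    ∃₂ λ k m → a ≡ p ^ suc k * m × ¬ p ∣ m
prime-power-split {p} p-prime a = go a (<-wellFounded a)
  where
  instance
    p≢0 : NonZero p
    p≢0 = prime⇒nonZero p-prime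
  go : ∀ a .{{_ : NonZero a}} → Acc _<_ a → p ∣ a → ∃₂ λ k m → a ≡ p ^ suc k * m × ¬ p ∣ m
  go _ (acc rec) (divides q refl) with p ∣? q
  ... | no p∤q  = 0 , q , trans (*-comm q p) (cong (_* q) (sym (*-identityʳ p))) , p∤q
  ... | yes p∣q = extend (go q (rec (m<m*n q p (prime⇒>1 p-prime))) p∣q)
    where
    instance
      q≢0 : NonZero q
      q≢0 = m*n≢0⇒m≢0 q
    extend : (∃₂ λ k m → q ≡ p ^ suc k * m × ¬ p ∣ m) → ∃₂ λ k m → q * p ≡ p ^ suc k * m × ¬ p ∣ m
    extend (k , m , refl , p∤m) =
      suc k , m , solve 3 (λ P m p → P :* m :* p := p :* P :* m) refl (p ^ suc k) m p , p∤m

module _ {p m} (p-prime : Prime p) (k : ℕ) .{{_ : NonZero m}} (p∤m : ¬ p ∣ m) where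
  private instance
    p^[1+k]≢0 : NonZero (p ^ suc k)
    p^[1+k]≢0 = prime^≢0 p-prime (suc k)
    p^[1+k]*m≢0 : NonZero (p ^ suc k * m)
    p^[1+k]*m≢0 = m*n≢0 (p ^ suc k) m

  cofactor-< : m < p ^ suc k * m
  cofactor-< = subst (m <_) (*-comm m (p ^ suc k)) (m<m*n m (p ^ suc k) (1<p^[1+k] p-prime k))

  ρ-prime-power-split : ρ (p ^ suc k * m) ≤ ρ (p ^ suc k) * ρ m
  ρ-prime-power-split = ρ-* (p ^ suc k) m (prime^-divisor p-prime p∤m (suc k))

  ω-prime-power-split : suc (ω m) ≤ ω (p ^ suc k * m)
  ω-prime-power-split = ω-cofactor p-prime (∣m⇒∣m*n m (m∣m*n (p ^ k))) (n∣m*n (p ^ suc k)) p∤m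

odd⇒ρ≤2^ω : ∀ a .{{_ : NonZero a}} → ¬ 2 ∣ a → ρ a ≤ 2 ^ ω a
odd⇒ρ≤2^ω a = go a (<-wellFounded a)
  where
  go : ∀ a .{{_ : NonZero a}} → Acc _<_ a → ¬ 2 ∣ a → ρ a ≤ 2 ^ ω a
  go a (acc rec) 2∤a with ≡1⊎∃prime∣ a
  ... | inj₁ refl = ≤-trans (ρ≤n {1}) (m^n>0 2 (ω 1))
  ... | inj₂ (p , p-prime , p∣a) with k , m , refl , p∤m ← prime-power-split p-prime a p∣a = begin
    ρ (p ^ suc k * m)        ≤⟨ ρ-prime-power-split p-prime k p∤m ⟩
    ρ (p ^ suc k) * ρ m      ≤⟨ *-mono-≤ (ρ-odd-prime-power≤2 p-prime k p≢2)
                                         (go m (rec (cofactor-< p-prime k p∤m)) 2∤m) ⟩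
    2 * 2 ^ ω m              ≤⟨ ^-monoʳ-≤ 2 (ω-prime-power-split p-prime k p∤m) ⟩
    2 ^ ω (p ^ suc k * m)    ∎
    where
    open ≤-Reasoning
    instance
      p^[1+k]≢0 : NonZero (p ^ suc k)
      p^[1+k]≢0 = prime^≢0 p-prime (suc k)
      m≢0 : NonZero m
      m≢0 = m*n≢0⇒n≢0 (p ^ suc k)
    p≢2 : p ≢ 2
    p≢2 refl = 2∤a p∣a
    2∤m : ¬ 2 ∣ m
    2∤m 2∣m = 2∤a (∣-trans 2∣m (n∣m*n (p ^ suc k)))

ρ≤2*2^ω : ∀ a .{{_ : NonZero a}} → ρ a ≤ 2 * 2 ^ ω a
ρ≤2*2^ω a with 2 ∣? a
... | no 2∤a  = ≤-trans (odd⇒ρ≤2^ω a 2∤a) (m≤n*m (2 ^ ω a) 2)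
... | yes 2∣a with k , m , refl , 2∤m ← prime-power-split prime[2] a 2∣a = begin
  ρ (2 ^ suc k * m)          ≤⟨ ρ-prime-power-split prime[2] k 2∤m ⟩
  ρ (2 ^ suc k) * ρ m        ≤⟨ *-mono-≤ (ρ-2-power≤4 (suc k)) (odd⇒ρ≤2^ω m 2∤m) ⟩
  4 * 2 ^ ω m                ≡⟨ *-assoc 2 2 (2 ^ ω m) ⟩
  2 * (2 * 2 ^ ω m)          ≤⟨ *-monoʳ-≤ 2 (^-monoʳ-≤ 2 (ω-prime-power-split prime[2] k 2∤m)) ⟩
  2 * 2 ^ ω (2 ^ suc k * m)  ∎
  where
  open ≤-Reasoning
  instance
    2^[1+k]≢0 : NonZero (2 ^ suc k)
    2^[1+k]≢0 = m^n≢0 2 (suc k)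
    m≢0 : NonZero m
    m≢0 = m*n≢0⇒n≢0 (2 ^ suc k)

neighbours : ℕ → ℕ → List ℕ
neighbours N a = filter (adjacent? a) [1‥ N ]

neighbours-unique : ∀ N a → Unique (neighbours N a)
neighbours-unique N a = filter⁺ (adjacent? a) (map⁺ suc-injective (upTo⁺ N))

∈-neighbours⁻ : ∀ {N a b} → b ∈ neighbours N a → b ≤ N × IsSquare (a * b + 1)
∈-neighbours⁻ {N} {a} b∈
  with b∈[1‥N] , (_ , ab+1-square) ← ∈-filter⁻ (adjacent? a) {xs = [1‥ N ]} b∈
  with i , i∈upTo , refl ← ∈-map⁻ suc b∈[1‥N]
  = ∈-upTo⁻ i∈upTo , ab+1-square

degree≤[1+Q]*ρ : ∀ N a .{{_ : NonZero a}} Q → (∀ {x} → x * x ≤ a * N + 1 → x / a ≤ Q) →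
                 degree N a ≤ suc Q * ρ a
degree≤[1+Q]*ρ N a Q x/a≤Q = length-≤-by-injection (neighbours-unique N a) code code-injective
  where
  root : ∀ {b} → b ∈ neighbours N a → ℕ
  root b∈ = proj₁ (proj₂ (∈-neighbours⁻ {N} {a} b∈))
  root² : ∀ {b} (b∈ : b ∈ neighbours N a) → root b∈ * root b∈ ≡ a * b + 1
  root² b∈ = proj₂ (proj₂ (∈-neighbours⁻ {N} {a} b∈))
  root%a∈ : ∀ {b} (b∈ : b ∈ neighbours N a) → root b∈ % a ∈ sqrtsOfOne a
  root%a∈ b∈ = %-∈-sqrtsOfOne {a} {a} {root b∈} ∣-refl (square⇒IsSqrtOfOne {a} {root b∈} (root² b∈))
  root/a≤Q : ∀ {b} (b∈ : b ∈ neighbours N a) → root b∈ / a ≤ Q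
  root/a≤Q b∈ = x/a≤Q (subst (_≤ a * N + 1) (sym (root² b∈))
                        (+-monoˡ-≤ 1 (*-monoʳ-≤ a (proj₁ (∈-neighbours⁻ {N} {a} b∈)))))
  code : ∀ {b} → b ∈ neighbours N a → Fin (suc Q * ρ a)
  code b∈ = combine (fromℕ< (s≤s (root/a≤Q b∈))) (index (root%a∈ b∈))
  code-injective : ∀ {b c} (b∈ : b ∈ neighbours N a) (c∈ : c ∈ neighbours N a) →
                   code b∈ ≡ code c∈ → b ≡ c
  code-injective {b} {c} b∈ c∈ eq with ≡/a , ≡%a ← combine-injective eq =
    *-cancelˡ-≡ b c a (+-cancelʳ-≡ 1 _ _ (begin
      a * b + 1            ≡⟨ root² b∈ ⟨
      root b∈ * root b∈    ≡⟨ cong (λ x → x * x) same-root ⟩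
      root c∈ * root c∈    ≡⟨ root² c∈ ⟩
      a * c + 1            ∎))
    where
    open ≡-Reasoning
    same-root : root b∈ ≡ root c∈
    same-root = /-%-injective (trans (sym (toℕ-fromℕ< _)) (trans (cong toℕ ≡/a) (toℕ-fromℕ< _)))
                              (index-injective (setoid ℕ) (root%a∈ b∈) (root%a∈ c∈) ≡%a)

[x/a]²*a≤1+N : ∀ {a N x} .{{_ : NonZero a}} → x * x ≤ a * N + 1 → (x / a) * (x / a) * a ≤ suc N
[x/a]²*a≤1+N {a} {N} {x} x²≤aN+1 = *-cancelʳ-≤ (q * q * a) (suc N) a (begin
  q * q * a * a       ≡⟨ solve 2 (λ q a → q :* q :* a :* a := (q :* a) :* (q :* a)) refl q a ⟩
  (q * a) * (q * a)   ≤⟨ *-mono-≤ (m/n*n≤m x a) (m/n*n≤m x a) ⟩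
  x * x               ≤⟨ x²≤aN+1 ⟩
  a * N + 1           ≤⟨ +-monoʳ-≤ (a * N) (>-nonZero⁻¹ a) ⟩
  a * N + a           ≡⟨ solve 2 (λ a N → a :* N :+ a := (con 1 :+ N) :* a) refl a N ⟩
  suc N * a           ∎)
  where
  open ≤-Reasoning
  q = x / a

[1+Q]²*a≤16*N : ∀ {N a Q} → 1 ≤ a → a ≤ N → Q * Q * a ≤ suc N → suc Q * suc Q * a ≤ 16 * N
[1+Q]²*a≤16*N {N}     {a} {zero}  _   a≤N _ =
  ≤-trans (≤-reflexive (+-identityʳ a)) (≤-trans a≤N (m≤n*m N 16))
[1+Q]²*a≤16*N {zero}  {a} {suc Q} 1≤a a≤0 _ = contradiction (≤-trans 1≤a a≤0) λ ()
[1+Q]²*a≤16*N {suc N} {a} {suc Q} _   _   [1+Q]²*a≤2+N = begin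
  (2 + Q) * (2 + Q) * a                              ≤⟨ m≤m+n _ ((3 * Q * Q + 4 * Q) * a) ⟩
  (2 + Q) * (2 + Q) * a + (3 * Q * Q + 4 * Q) * a    ≡⟨ solve 2 (λ Q a → (con 2 :+ Q) :* (con 2 :+ Q) :* a
                                                                      :+ (con 3 :* Q :* Q :+ con 4 :* Q) :* a
                                                                   := con 4 :* ((con 1 :+ Q) :* (con 1 :+ Q) :* a))
                                                                refl Q a ⟩
  4 * ((1 + Q) * (1 + Q) * a)                        ≤⟨ *-monoʳ-≤ 4 [1+Q]²*a≤2+N ⟩
  4 * (2 + N)                                        ≤⟨ m≤m+n _ (8 + 12 * N) ⟩
  4 * (2 + N) + (8 + 12 * N)                         ≡⟨ solve 1 (λ N → con 4 :* (con 2 :+ N) :+ (con 8 :+ con 12 :* N)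
                                                                   := con 16 :* (con 1 :+ N)) refl N ⟩
  16 * suc N                                         ∎
  where open ≤-Reasoning

degree²*a≤16*N*ρ² : ∀ N a .{{_ : NonZero a}} → a ≤ N → degree N a * degree N a * a ≤ 16 * N * (ρ a * ρ a)
degree²*a≤16*N*ρ² N a a≤N = begin
  degree N a * degree N a * a          ≤⟨ *-monoˡ-≤ a (*-mono-≤ degree≤ degree≤) ⟩
  (suc Q * ρ a) * (suc Q * ρ a) * a    ≡⟨ solve 3 (λ Q r a → ((con 1 :+ Q) :* r) :* ((con 1 :+ Q) :* r) :* a
                                                       := (con 1 :+ Q) :* (con 1 :+ Q) :* a :* (r :* r))
                                                    refl Q (ρ a) a ⟩
  suc Q * suc Q * a * (ρ a * ρ a)      ≤⟨ *-monoˡ-≤ (ρ a * ρ a) [1+Q]²*a≤16N ⟩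
  16 * N * (ρ a * ρ a)                 ∎
  where
  open ≤-Reasoning
  fits? : Decidable (λ q → q * q * a ≤ suc N)
  fits? q = q * q * a ≤? suc N
  Q = greatest fits? (suc N)
  [1+Q]²*a≤16N : suc Q * suc Q * a ≤ 16 * N
  [1+Q]²*a≤16N = [1+Q]²*a≤16*N {N} {a} {Q} (>-nonZero⁻¹ a) a≤N (greatest-satisfies fits? z≤n (suc N))
  degree≤ : degree N a ≤ suc Q * ρ a
  degree≤ = degree≤[1+Q]*ρ N a Q λ x²≤aN+1 →
    greatest-≥ fits? (≤-trans (m≤m*m*n _ a) ([x/a]²*a≤1+N x²≤aN+1)) ([x/a]²*a≤1+N x²≤aN+1)

lemma5 : (N a : ℕ) → 1 ≤ a → a ≤ N →
    degree N a ^ 2 * a ≤ 64 * N * 4 ^ ω a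
lemma5 N a 1≤a a≤N = begin
  degree N a ^ 2 * a                         ≡⟨ cong (λ d → degree N a * d * a) (*-identityʳ (degree N a)) ⟩
  degree N a * degree N a * a                ≤⟨ degree²*a≤16*N*ρ² N a a≤N ⟩
  16 * N * (ρ a * ρ a)                       ≤⟨ *-monoʳ-≤ (16 * N) (*-mono-≤ (ρ≤2*2^ω a) (ρ≤2*2^ω a)) ⟩
  16 * N * ((2 * 2 ^ ω a) * (2 * 2 ^ ω a))   ≡⟨ cong (16 * N *_) (m^n*m^n≡[m*m]^n 2 (suc (ω a))) ⟩
  16 * N * (4 * 4 ^ ω a)                     ≡⟨ solve 2 (λ N t → con 16 :* N :* (con 4 :* t) := con 64 :* N :* t)
                                                        refl N (4 ^ ω a) ⟩
  64 * N * 4 ^ ω a                           ∎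
  where
  open ≤-Reasoning
  instance
    a≢0 : NonZero a
    a≢0 = >-nonZero 1≤a
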